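{- Let $V$ be a finite set and $U_1,\dots,U_k$ a partition of $V$. Let $\mathcal{U} = \{ \bigcup_{i \in I} U_i : I \subseteq \{1,\dots,k\}\}$ and define $f \colon 2^V \to \mathbb{R}$ by $f(X) = \min_{W \in \mathcal{U}} |X \vartriangle W|$. Then for $S \subseteq V$, the function $X \mapsto f(X \vartriangle S)$ is submodular if and only if $S \in \mathcal{U}$.
   Context: $X \vartriangle W$ is the symmetric difference. A set function $h$ on $2^V$ is submodular if $h(X)+h(Y) \ge h(X \cup Y) + h(X \cap Y)$ for all $X,Y \subseteq V$. -}

module Defs where

open import Data.Nat using (ℕ; zero; suc; _+_; _≤_; _⊓_)
open import Data.Fin using (Fin)
open import Data.Fin.Subset using (Subset; _∪_; _∩_; ∣_∣; ⊥)
open import Data.Bool using (Bool; true; false; _xor_)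
open import Data.Vec using (Vec; []; _∷_; zipWith; tabulate; lookup)
open import Data.List using (List; []; _∷_; map; _++_; foldr)
open import Data.Product using (∃)
open import Relation.Binary.PropositionalEquality using (_≡_)

infixl 5 _△_
_△_ : {n : ℕ} → Subset n → Subset n → Subset n
_△_ = zipWith _xor_

-- A partition U_1,…,U_k of V is given by the block map p : Fin n → Fin k
-- (U_i = p⁻¹(i)); nonemptiness of the blocks is surjectivity of p.
-- The union of the blocks U_i with i ∈ I:
blockUnion : {n k : ℕ} → (Fin n → Fin k) → Subset k → Subset n
blockUnion p I = tabulate (λ v → lookup I (p v))

InU : {n k : ℕ} → (Fin n → Fin k) → Subset n → Set
InU p S = ∃ λ I → S ≡ blockUnion p I

allSubsets : (k : ℕ) → List (Subset k)
allSubsets zero = [] ∷ []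
allSubsets (suc k) = map (true ∷_) (allSubsets k) ++ map (false ∷_) (allSubsets k)

-- f(X) = min_{W ∈ 𝒰} |X △ W|.  The min is a fold of ⊓ over all I ⊆ Fin k,
-- seeded with |X △ ∅| (∅ = union over I = ∅ is itself in 𝒰, so this is exactly the minimum).
f : {n k : ℕ} → (Fin n → Fin k) → Subset n → ℕ
f {n} {k} p X = foldr (λ I m → ∣ X △ blockUnion p I ∣ ⊓ m) ∣ X △ ⊥ ∣ (allSubsets k)

Submodular : {n : ℕ} → (Subset n → ℕ) → Set
Submodular {n} h = ∀ (X Y : Subset n) → h (X ∪ Y) + h (X ∩ Y) ≤ h X + h Y

module Submission where

-- Write W_I = blockUnion p I for the union of the blocks indexed by I, so
-- that 𝒰 = { W_I } and f(X) = min_I |X △ W_I|.  The proof rests on three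
-- structural facts about 𝒰:
--   * I ↦ W_I commutes with every pointwise Boolean operation, so 𝒰 is closed
--     under ∪, ∩ and △ (a sublattice and a subgroup of (2^V, △));
--   * |(A ∪ B) △ (C ∪ D)| + |(A ∩ B) △ (C ∩ D)| ≤ |A △ C| + |B △ D|, a
--     pointwise truth-table inequality summed over V;
--   * a set Z that splits a block (contains exactly one of two elements of the
--     same block) has f(Z) ≥ 1, since every W_I meets a block fully or not at all.
-- From the first two, f is submodular (compare the optimal W_I, W_J for X, Y
-- with W_{I∪J}, W_{I∩J}), and f(X △ W_M) = f(X) since △ W_M permutes 𝒰; this
-- gives "S ∈ 𝒰 ⇒ submodular".  Conversely, if S splits a block U_i, then
-- X = S and Y = U_i △ S violate submodularity: f(X △ S) = f(Y △ S) = 0,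
-- while (X ∪ Y) △ S = U_i ∖ S and (X ∩ Y) △ S = U_i ∩ S both split U_i.
-- So a submodular shift S is constant on blocks, hence (p being onto) S ∈ 𝒰.

open import Defs
open import Data.Nat using (ℕ; zero; suc; _+_; _≤_; _⊓_; z≤n; s≤s)
open import Data.Nat.Properties
  using (≤-trans; +-mono-≤; m⊓n≤m; m⊓n≤n; ⊓-sel; ≤-antisym; n≤0⇒n≡0; +-commutativeSemigroup; module ≤-Reasoning)
open import Algebra.Properties.CommutativeSemigroup +-commutativeSemigroup using (interchange)
open import Data.Fin using (Fin)
import Data.Fin as Fin
open import Data.Fin.Subset using (Subset; _∪_; _∩_; ∣_∣; ⊥; ⁅_⁆; _∈_)
open import Data.Fin.Subset.Properties using (∣⊥∣≡0; ∣⁅x⁆∣≡1; x∈⁅x⁆; x∈⁅y⁆⇒x≡y; p⊆q⇒∣p∣≤∣q∣)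
open import Data.Bool using (Bool; true; false; _xor_; _∨_; _∧_; not)
open import Data.Bool.Properties using (xor-assoc; xor-same; xor-identityˡ; xor-identityʳ; not-injective)
import Data.Bool.Properties as Bool
open import Data.Vec using (Vec; []; _∷_; zipWith; tabulate; lookup)
open import Data.Vec.Properties
  using (lookup-zipWith; lookup∘tabulate; tabulate∘lookup; tabulate-cong; zipWith-assoc; zipWith-identityˡ; zipWith-identityʳ; lookup-replicate; []=⇒lookup; lookup⇒[]=)
open import Data.List using (List; map; foldr)
import Data.List as List
open import Data.List.Membership.Propositional using () renaming (_∈_ to _∈ₗ_)
open import Data.List.Membership.Propositional.Properties using (∈-map⁺; ∈-++⁺ˡ; ∈-++⁺ʳ)
open import Data.List.Relation.Unary.Any using (here; there)
open import Data.Product using (∃; _,_; proj₁; proj₂)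
open import Data.Sum using (_⊎_; inj₁; inj₂)
open import Data.Empty using (⊥-elim)
open import Relation.Nullary using (yes; no; ¬_)
open import Function.Definitions using (Surjective)
open import Function.Bundles using (_⇔_; mk⇔)
open import Relation.Binary.PropositionalEquality

vec-ext : {A : Set} {n : ℕ} {xs ys : Vec A n} → (∀ i → lookup xs i ≡ lookup ys i) → xs ≡ ys
vec-ext {xs = xs} {ys} same =
  trans (sym (tabulate∘lookup xs)) (trans (tabulate-cong same) (tabulate∘lookup ys))

-- Symmetric difference makes Subset n a Boolean group with identity ⊥;
-- these laws let △ W_M act as a bijection on 𝒰.

△-assoc : {n : ℕ} (X Y Z : Subset n) → (X △ Y) △ Z ≡ X △ (Y △ Z)
△-assoc = zipWith-assoc xor-assoc

△-identityˡ : {n : ℕ} (X : Subset n) → ⊥ △ X ≡ X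
△-identityˡ = zipWith-identityˡ xor-identityˡ

△-identityʳ : {n : ℕ} (X : Subset n) → X △ ⊥ ≡ X
△-identityʳ = zipWith-identityʳ xor-identityʳ

△-self : {n : ℕ} (X : Subset n) → X △ X ≡ ⊥
△-self []      = refl
△-self (x ∷ X) = cong₂ _∷_ (xor-same x) (△-self X)

△-cancel : {n : ℕ} (X A C : Subset n) → (X △ A) △ (A △ C) ≡ X △ C
△-cancel X A C = begin
  (X △ A) △ (A △ C) ≡⟨ △-assoc X A (A △ C) ⟩
  X △ (A △ (A △ C)) ≡⟨ cong (X △_) (sym (△-assoc A A C)) ⟩
  X △ ((A △ A) △ C) ≡⟨ cong (λ Z → X △ (Z △ C)) (△-self A) ⟩
  X △ (⊥ △ C)       ≡⟨ cong (X △_) (△-identityˡ C) ⟩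
  X △ C             ∎
  where open ≡-Reasoning

module Blocks {n k : ℕ} (p : Fin n → Fin k) where

  W : Subset k → Subset n
  W = blockUnion p

  lookup-W : (I : Subset k) (v : Fin n) → lookup (W I) v ≡ lookup I (p v)
  lookup-W I v = lookup∘tabulate _ v

  W-zipWith : (g : Bool → Bool → Bool) (I J : Subset k) → W (zipWith g I J) ≡ zipWith g (W I) (W J)
  W-zipWith g I J = vec-ext λ v → begin
    lookup (W (zipWith g I J)) v              ≡⟨ lookup-W (zipWith g I J) v ⟩
    lookup (zipWith g I J) (p v)              ≡⟨ lookup-zipWith g (p v) I J ⟩
    g (lookup I (p v)) (lookup J (p v))       ≡⟨ sym (cong₂ g (lookup-W I v) (lookup-W J v)) ⟩
    g (lookup (W I) v) (lookup (W J) v)       ≡⟨ sym (lookup-zipWith g v (W I) (W J)) ⟩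
    lookup (zipWith g (W I) (W J)) v          ∎
    where open ≡-Reasoning

  W-⊥ : W ⊥ ≡ ⊥
  W-⊥ = vec-ext λ v → trans (lookup-W ⊥ v) (trans (lookup-replicate (p v) false) (sym (lookup-replicate v false)))

  -- When p is onto, a set that is constant on every block is a union of
  -- blocks: take I = { j : S contains a chosen representative of block j }.
  constant-on-blocks⇒InU : Surjective _≡_ _≡_ p → (S : Subset n) →
    (∀ u w → p u ≡ p w → lookup S u ≡ lookup S w) → InU p S
  constant-on-blocks⇒InU onto S constant = I , vec-ext λ u → sym (begin
    lookup (W I) u          ≡⟨ lookup-W I u ⟩
    lookup I (p u)          ≡⟨ lookup∘tabulate _ (p u) ⟩
    lookup S (rep (p u))    ≡⟨ constant (rep (p u)) u (rep-in-block (p u)) ⟩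
    lookup S u              ∎)
    where
    open ≡-Reasoning
    rep : Fin k → Fin n
    rep j = proj₁ (onto j)
    rep-in-block : ∀ j → p (rep j) ≡ j
    rep-in-block j = proj₂ (onto j) refl
    I : Subset k
    I = tabulate (λ j → lookup S (rep j))

bit : Bool → ℕ
bit true  = 1
bit false = 0

∣∷∣ : {n : ℕ} (x : Bool) (X : Subset n) → ∣ x ∷ X ∣ ≡ bit x + ∣ X ∣
∣∷∣ true  X = refl
∣∷∣ false X = refl

member⇒∣∣≥1 : {n : ℕ} (Z : Subset n) (v : Fin n) → lookup Z v ≡ true → 1 ≤ ∣ Z ∣
member⇒∣∣≥1 Z v Zv = subst (_≤ ∣ Z ∣) (∣⁅x⁆∣≡1 v) (p⊆q⇒∣p∣≤∣q∣ ⁅v⁆⊆Z)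
  where
  ⁅v⁆⊆Z : ∀ {x} → x ∈ ⁅ v ⁆ → x ∈ Z
  ⁅v⁆⊆Z x∈ = subst (_∈ Z) (sym (x∈⁅y⁆⇒x≡y v x∈)) (lookup⇒[]= v Z Zv)

bit-lattice-ineq : ∀ a b c d →
  bit ((a ∨ b) xor (c ∨ d)) + bit ((a ∧ b) xor (c ∧ d)) ≤ bit (a xor c) + bit (b xor d)
bit-lattice-ineq true  true  true  true  = z≤n
bit-lattice-ineq true  true  true  false = s≤s z≤n
bit-lattice-ineq true  true  false true  = s≤s z≤n
bit-lattice-ineq true  true  false false = s≤s (s≤s z≤n)
bit-lattice-ineq true  false true  true  = s≤s z≤n
bit-lattice-ineq true  false true  false = z≤n
bit-lattice-ineq true  false false true  = z≤n
bit-lattice-ineq true  false false false = s≤s z≤n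
bit-lattice-ineq false true  true  true  = s≤s z≤n
bit-lattice-ineq false true  true  false = z≤n
bit-lattice-ineq false true  false true  = z≤n
bit-lattice-ineq false true  false false = s≤s z≤n
bit-lattice-ineq false false true  true  = s≤s (s≤s z≤n)
bit-lattice-ineq false false true  false = s≤s z≤n
bit-lattice-ineq false false false true  = s≤s z≤n
bit-lattice-ineq false false false false = z≤n

△-lattice-ineq : {n : ℕ} (A B C D : Subset n) →
  ∣ (A ∪ B) △ (C ∪ D) ∣ + ∣ (A ∩ B) △ (C ∩ D) ∣ ≤ ∣ A △ C ∣ + ∣ B △ D ∣
△-lattice-ineq []      []      []      []      = z≤n
△-lattice-ineq (a ∷ A) (b ∷ B) (c ∷ C) (d ∷ D) = begin
  ∣ x ∷ X ∣ + ∣ y ∷ Y ∣           ≡⟨ cong₂ _+_ (∣∷∣ x X) (∣∷∣ y Y) ⟩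
  (bit x + ∣ X ∣) + (bit y + ∣ Y ∣) ≡⟨ interchange (bit x) (∣ X ∣) (bit y) (∣ Y ∣) ⟩
  (bit x + bit y) + (∣ X ∣ + ∣ Y ∣) ≤⟨ +-mono-≤ (bit-lattice-ineq a b c d) (△-lattice-ineq A B C D) ⟩
  (bit z + bit w) + (∣ Z ∣ + ∣ V ∣) ≡⟨ interchange (bit z) (bit w) (∣ Z ∣) (∣ V ∣) ⟩
  (bit z + ∣ Z ∣) + (bit w + ∣ V ∣) ≡⟨ sym (cong₂ _+_ (∣∷∣ z Z) (∣∷∣ w V)) ⟩
  ∣ z ∷ Z ∣ + ∣ w ∷ V ∣           ∎
  where
  open ≤-Reasoning
  x y z w : Bool
  x = (a ∨ b) xor (c ∨ d)
  y = (a ∧ b) xor (c ∧ d)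
  z = a xor c
  w = b xor d
  X Y Z V : Subset _
  X = (A ∪ B) △ (C ∪ D)
  Y = (A ∩ B) △ (C ∩ D)
  Z = A △ C
  V = B △ D

lookup-join-shift : {n : ℕ} (S B : Subset n) (v : Fin n) →
  lookup ((S ∪ (B △ S)) △ S) v ≡ lookup B v ∧ not (lookup S v)
lookup-join-shift (true  ∷ S) (true  ∷ B) Fin.zero = refl
lookup-join-shift (true  ∷ S) (false ∷ B) Fin.zero = refl
lookup-join-shift (false ∷ S) (true  ∷ B) Fin.zero = refl
lookup-join-shift (false ∷ S) (false ∷ B) Fin.zero = refl
lookup-join-shift (s ∷ S) (b ∷ B) (Fin.suc v) = lookup-join-shift S B v

lookup-meet-shift : {n : ℕ} (S B : Subset n) (v : Fin n) →
  lookup ((S ∩ (B △ S)) △ S) v ≡ lookup B v ∧ lookup S v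
lookup-meet-shift (true  ∷ S) (true  ∷ B) Fin.zero = refl
lookup-meet-shift (true  ∷ S) (false ∷ B) Fin.zero = refl
lookup-meet-shift (false ∷ S) (true  ∷ B) Fin.zero = refl
lookup-meet-shift (false ∷ S) (false ∷ B) Fin.zero = refl
lookup-meet-shift (s ∷ S) (b ∷ B) (Fin.suc v) = lookup-meet-shift S B v

module MinOver {A : Set} (g : A → ℕ) where

  minOver : ℕ → List A → ℕ
  minOver s = foldr (λ a m → g a ⊓ m) s

  minOver-≤ : ∀ s xs {a} → a ∈ₗ xs → minOver s xs ≤ g a
  minOver-≤ s (x List.∷ xs) (here refl) = m⊓n≤m (g x) _
  minOver-≤ s (x List.∷ xs) (there a∈) = ≤-trans (m⊓n≤n (g x) _) (minOver-≤ s xs a∈)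

  minOver-attained : ∀ s xs → minOver s xs ≡ s ⊎ ∃ λ a → minOver s xs ≡ g a
  minOver-attained s List.[] = inj₁ refl
  minOver-attained s (x List.∷ xs) with ⊓-sel (g x) (minOver s xs)
  ... | inj₁ is-x = inj₂ (x , is-x)
  ... | inj₂ is-rest with minOver-attained s xs
  ...   | inj₁ is-s       = inj₁ (trans is-rest is-s)
  ...   | inj₂ (a , is-a) = inj₂ (a , trans is-rest is-a)

allSubsets-complete : (k : ℕ) (I : Subset k) → I ∈ₗ allSubsets k
allSubsets-complete zero    []      = here refl
allSubsets-complete (suc k) (true ∷ I)  = ∈-++⁺ˡ (∈-map⁺ (true ∷_) (allSubsets-complete k I))
allSubsets-complete (suc k) (false ∷ I) =
  ∈-++⁺ʳ (map (true ∷_) (allSubsets k)) (∈-map⁺ (false ∷_) (allSubsets-complete k I))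

module Distance {n k : ℕ} (p : Fin n → Fin k) where
  open Blocks p

  f-≤ : (X : Subset n) (I : Subset k) → f p X ≤ ∣ X △ W I ∣
  f-≤ X I = minOver-≤ ∣ X △ ⊥ ∣ (allSubsets k) (allSubsets-complete k I)
    where open MinOver (λ J → ∣ X △ W J ∣)

  f-attained : (X : Subset n) → ∃ λ I → f p X ≡ ∣ X △ W I ∣
  f-attained X with minOver-attained ∣ X △ ⊥ ∣ (allSubsets k)
    where open MinOver (λ J → ∣ X △ W J ∣)
  ... | inj₁ is-seed = ⊥ , trans is-seed (cong (λ Z → ∣ X △ Z ∣) (sym W-⊥))
  ... | inj₂ attained = attained

  f-on-U : (I : Subset k) → f p (W I) ≡ 0
  f-on-U I = n≤0⇒n≡0 (subst (f p (W I) ≤_) (trans (cong ∣_∣ (△-self (W I))) (∣⊥∣≡0 n)) (f-≤ (W I) I))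

  -- f is invariant under translation by a member of 𝒰, because
  -- X △ W_M △ W_J = X △ W_{M △ J} and J ↦ M △ J is a bijection.
  f-translate : (M : Subset k) (X : Subset n) → f p (X △ W M) ≡ f p X
  f-translate M X = ≤-antisym translated≤ ≤translated
    where
    translated≤ : f p (X △ W M) ≤ f p X
    translated≤ with f-attained X
    ... | J , fX≡ = subst (f p (X △ W M) ≤_) (sym (trans fX≡ (cong ∣_∣ shift))) (f-≤ (X △ W M) (M △ J))
      where
      shift : X △ W J ≡ (X △ W M) △ W (M △ J)
      shift = sym (trans (cong ((X △ W M) △_) (W-zipWith _xor_ M J)) (△-cancel X (W M) (W J)))
    ≤translated : f p X ≤ f p (X △ W M)
    ≤translated with f-attained (X △ W M)
    ... | J , fXM≡ = subst (f p X ≤_) (sym (trans fXM≡ (cong ∣_∣ shift))) (f-≤ X (M △ J))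
      where
      shift : (X △ W M) △ W J ≡ X △ W (M △ J)
      shift = trans (△-assoc X (W M) (W J)) (cong (X △_) (sym (W-zipWith _xor_ M J)))

  -- f is submodular: if W_I, W_J are closest to X, Y then W_{I∪J}, W_{I∩J}
  -- are candidates for X ∪ Y, X ∩ Y, and the lattice inequality compares the distances.
  f-submodular : Submodular (f p)
  f-submodular X Y with f-attained X | f-attained Y
  ... | I , fX≡ | J , fY≡ = begin
    f p (X ∪ Y) + f p (X ∩ Y)
      ≤⟨ +-mono-≤ (f-≤ (X ∪ Y) (I ∪ J)) (f-≤ (X ∩ Y) (I ∩ J)) ⟩
    ∣ (X ∪ Y) △ W (I ∪ J) ∣ + ∣ (X ∩ Y) △ W (I ∩ J) ∣
      ≡⟨ cong₂ (λ A B → ∣ (X ∪ Y) △ A ∣ + ∣ (X ∩ Y) △ B ∣) (W-zipWith _∨_ I J) (W-zipWith _∧_ I J) ⟩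
    ∣ (X ∪ Y) △ (W I ∪ W J) ∣ + ∣ (X ∩ Y) △ (W I ∩ W J) ∣
      ≤⟨ △-lattice-ineq X Y (W I) (W J) ⟩
    ∣ X △ W I ∣ + ∣ Y △ W J ∣
      ≡⟨ sym (cong₂ _+_ fX≡ fY≡) ⟩
    f p X + f p Y ∎
    where open ≤-Reasoning

  -- A set containing exactly one of two elements of the same block has f ≥ 1:
  -- W_I contains both or neither, so X △ W_I contains one of them.
  f-split : (Z : Subset n) (u w : Fin n) → p u ≡ p w → lookup Z u ≢ lookup Z w → 1 ≤ f p Z
  f-split Z u w same-block splits with f-attained Z
  ... | I , fZ≡ = subst (1 ≤_) (sym fZ≡) (witness (xor-separates (lookup Z u) (lookup Z w) (lookup I (p u)) splits))
    where
    xor-separates : ∀ z z′ j → z ≢ z′ → z xor j ≡ true ⊎ z′ xor j ≡ true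
    xor-separates true  true  j ne = ⊥-elim (ne refl)
    xor-separates false false j ne = ⊥-elim (ne refl)
    xor-separates true  false true  ne = inj₂ refl
    xor-separates true  false false ne = inj₁ refl
    xor-separates false true  true  ne = inj₁ refl
    xor-separates false true  false ne = inj₂ refl
    lookup-dist : ∀ v → p v ≡ p u → lookup (Z △ W I) v ≡ lookup Z v xor lookup I (p u)
    lookup-dist v pv≡ = trans (lookup-zipWith _xor_ v Z (W I)) (cong (lookup Z v xor_) (trans (lookup-W I v) (cong (lookup I) pv≡)))
    witness : lookup Z u xor lookup I (p u) ≡ true ⊎ lookup Z w xor lookup I (p u) ≡ true → 1 ≤ ∣ Z △ W I ∣
    witness (inj₁ at-u) = member⇒∣∣≥1 (Z △ W I) u (trans (lookup-dist u refl) at-u)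
    witness (inj₂ at-w) = member⇒∣∣≥1 (Z △ W I) w (trans (lookup-dist w (sym same-block)) at-w)

  -- If S splits a block U_i (two elements u, w of U_i with S u ≠ S w), then
  -- h(X) = f(X △ S) violates submodularity at X = S, Y = U_i △ S: here
  -- h(X) = f(∅) = 0 and h(Y) = f(U_i) = 0, while (X ∪ Y) △ S = U_i ∖ S and
  -- (X ∩ Y) △ S = U_i ∩ S both split U_i, so each has f ≥ 1.
  split⇒¬submodular : (S : Subset n) (u w : Fin n) → p u ≡ p w → lookup S u ≢ lookup S w →
    ¬ Submodular (λ X → f p (X △ S))
  split⇒¬submodular S u w same-block splits submodular = 2≰0 (begin
    1 + 1                                        ≤⟨ +-mono-≤ (f-split (join △ S) u w same-block join-splits)
                                                             (f-split (meet △ S) u w same-block meet-splits) ⟩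
    f p (join △ S) + f p (meet △ S)             ≤⟨ submodular S (U △ S) ⟩
    f p (S △ S) + f p ((U △ S) △ S)             ≡⟨ cong₂ (λ A B → f p A + f p B) S△S≡W⊥ U△S△S≡U ⟩
    f p (W ⊥) + f p U                           ≡⟨ cong₂ _+_ (f-on-U ⊥) (f-on-U ⁅ p u ⁆) ⟩
    0 ∎)
    where
    open ≤-Reasoning
    U : Subset n
    U = W ⁅ p u ⁆
    join meet : Subset n
    join = S ∪ (U △ S)
    meet = S ∩ (U △ S)
    2≰0 : ¬ (2 ≤ 0)
    2≰0 ()

    S△S≡W⊥ : S △ S ≡ W ⊥
    S△S≡W⊥ = trans (△-self S) (sym W-⊥)
    U△S△S≡U : (U △ S) △ S ≡ U
    U△S△S≡U = trans (△-assoc U S S) (trans (cong (U △_) (△-self S)) (△-identityʳ U))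

    in-U : ∀ v → p v ≡ p u → lookup U v ≡ true
    in-U v pv≡ = trans (lookup-W ⁅ p u ⁆ v) (trans (cong (lookup ⁅ p u ⁆) pv≡) ([]=⇒lookup (x∈⁅x⁆ (p u))))

    splits-via : (Z : Subset n) (g : Bool → Bool) → (∀ {a b} → g a ≡ g b → a ≡ b) →
      (∀ v → p v ≡ p u → lookup Z v ≡ g (lookup S v)) → lookup Z u ≢ lookup Z w
    splits-via Z g g-injective on-block Zu≡Zw =
      splits (g-injective (trans (sym (on-block u refl)) (trans Zu≡Zw (on-block w (sym same-block)))))

    join-splits : lookup (join △ S) u ≢ lookup (join △ S) w
    join-splits = splits-via (join △ S) not not-injective
      λ v pv≡ → trans (lookup-join-shift S U v) (cong (λ b → b ∧ not (lookup S v)) (in-U v pv≡))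

    meet-splits : lookup (meet △ S) u ≢ lookup (meet △ S) w
    meet-splits = splits-via (meet △ S) (λ b → b) (λ eq → eq)
      λ v pv≡ → trans (lookup-meet-shift S U v) (cong (λ b → b ∧ lookup S v) (in-U v pv≡))

  submodular⇒constant-on-blocks : (S : Subset n) → Submodular (λ X → f p (X △ S)) →
    ∀ u w → p u ≡ p w → lookup S u ≡ lookup S w
  submodular⇒constant-on-blocks S submodular u w same-block with lookup S u Bool.≟ lookup S w
  ... | yes equal = equal
  ... | no splits = ⊥-elim (split⇒¬submodular S u w same-block splits submodular)

submodular-cong : {n : ℕ} {g h : Subset n → ℕ} → (∀ X → g X ≡ h X) → Submodular h → Submodular g
submodular-cong g≗h submodular X Y =
  subst₂ _≤_ (sym (cong₂ _+_ (g≗h (X ∪ Y)) (g≗h (X ∩ Y)))) (sym (cong₂ _+_ (g≗h X) (g≗h Y))) (submodular X Y)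

proposition3p12 : (n k : ℕ) (p : Fin n → Fin k) → Surjective _≡_ _≡_ p → (S : Subset n)
    → Submodular (λ X → f p (X △ S)) ⇔ InU p S
proposition3p12 n k p onto S = mk⇔ submodular⇒InU InU⇒submodular
  where
  open Blocks p
  open Distance p
  submodular⇒InU : Submodular (λ X → f p (X △ S)) → InU p S
  submodular⇒InU submodular =
    constant-on-blocks⇒InU onto S (submodular⇒constant-on-blocks S submodular)
  InU⇒submodular : InU p S → Submodular (λ X → f p (X △ S))
  InU⇒submodular (M , refl) = submodular-cong (f-translate M) f-submodular
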